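{- Let $p$ be a prime and let $x_1,\dots,x_n$ be positive integers with $\frac{1}{x_1}+\dots+\frac{1}{x_n}=1$, with $p$ dividing at least one $x_i$. Let $\alpha=\max_i v_p(x_i)$ and suppose the indices $i$ with $v_p(x_i)=\alpha$ are exactly $i_1,\dots,i_s$ with $s\geq 2$; write $x_{i_t}=p^{\alpha}x'_{i_t}$ with $p\nmid x'_{i_t}$. Let $k_1,\dots,k_{s-1}$ be $s-1$ distinct elements of $\{1,\dots,s\}$. Then $$v_p\big(\sigma_{s-2}(x'_{i_{k_1}},\dots,x'_{i_{k_{s-1}}})\big)=0.$$
   Context: $v_p$ is the $p$-adic valuation. $\sigma_k(a_1,\dots,a_m)=\sum_{1\leq j_1<\dots<j_k\leq m}a_{j_1}\cdots a_{j_k}$ is the $k$-th elementary symmetric function, with $\sigma_0=1$. -}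

module Defs where

open import Data.Nat using (ℕ; zero; suc; _+_; _*_; _^_; NonZero)
open import Data.Nat.Divisibility using (_∣_)
open import Data.Integer using (+_)
open import Data.Rational using (ℚ; 0ℚ; _/_) renaming (_+_ to _+ℚ_)
open import Data.List using (List; []; _∷_; map; foldr)
open import Data.Fin using (Fin)
open import Data.List using (allFin) public
open import Data.Product using (_×_)
open import Relation.Nullary using (¬_)

-- p-adic valuation as a relation: v_p(y) = a  iff  p^a ∣ y and p^(a+1) ∤ y
-- (used for positive y, where the valuation is well-defined)
VP : ℕ → ℕ → ℕ → Set
VP p y a = (p ^ a) ∣ y × ¬ ((p ^ suc a) ∣ y)

σ : ℕ → List ℕ → ℕ
σ zero    _        = 1
σ (suc k) []       = 0
σ (suc k) (a ∷ as) = a * σ k as + σ (suc k) as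

listOf : ∀ {m} → (Fin m → ℕ) → List ℕ
listOf {m} f = map f (allFin m)

sumRecip : ∀ {n} (x : Fin n → ℕ) → (∀ i → NonZero (x i)) → ℚ
sumRecip {n} x pos = foldr _+ℚ_ 0ℚ (map (λ i → _/_ (+ 1) (x i) {{pos i}}) (allFin n))

-- Write x i = p ^ a i * y i with p ∤ y i.  Clearing denominators in Σ 1/x i = 1 with
-- c = p ^ α * ∏ y gives Σ_i p ^ (α - a i) * ∏_{j ≠ i} y j = c.  Modulo p only the indices
-- with a i = α survive, and multiplying by the product of the inverses of the y j turns the
-- relation into Σ_t v t ≡ 0, where v t is an inverse of x′ t.  If p divided
-- σ_{s-2}(x′ (k j))_j = Σ_j ∏_{l ≠ j} x′ (k l), multiplying by ∏_j v (k j) would give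
-- Σ_j v (k j) ≡ 0, so the inverse v t of the one index t missed by k would vanish mod p.
module Submission where

open import Defs
open import Data.Nat using (ℕ; zero; suc; _+_; _*_; _^_; _∸_; _≤_; _<_; z≤n; s≤s; NonZero; ≢-nonZero; nonTrivial⇒n>1)
open import Data.Nat.Properties
  using ( +-*-semiring; *-1-commutativeMonoid; *-commutativeSemigroup; suc-injective
        ; +-comm; +-identityʳ; +-cancelˡ-≡; m+n≡0⇒m≡0; m+n≡0⇒n≡0; m+[n∸m]≡n; m∸n+n≡m; n∸n≡0; m>n⇒m∸n≢0
        ; *-comm; *-identityˡ; *-identityʳ; *-zeroʳ; *-distribʳ-+; *-cancelˡ-≡; m*n≢0; m^n≢0; ^-distribˡ-+-*
        ; ≤-reflexive; <⇒≢; <-cmp; m<n⇒m<1+n; n<1+n; n≤0⇒n≡0; m≤n⇒m<n∨m≡n )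
open import Data.Nat.DivMod using (_%_; %-distribˡ-+; %-distribˡ-*; [m+kn]%n≡m%n)
open import Data.Nat.Divisibility
  using (_∣_; divides; _∣0; 1∣_; ∣1⇒≡1; ∣-trans; *-monoˡ-∣; m∣m*n; ∣m⇒∣m*n; n∣m⇒m%n≡0; m%n≡0⇒n∣m)
open import Data.Nat.Primality using (Prime; prime⇒nonZero; prime⇒nonTrivial; prime⇒irreducible)
open import Data.Nat.Coprimality using (Coprime; coprime-Bézout)
open import Data.Nat.GCD using (module Bézout)
open import Data.Nat.Tactic.RingSolver using (solve-∀)
open import Data.Integer as ℤ using (+_)
import Data.Integer.Properties as ℤP
open import Data.Rational using (0ℚ; 1ℚ; toℚᵘ) renaming (_+_ to _+ℚ_; _/_ to _/ℚ_)
open import Data.Rational.Properties using (toℚᵘ-fromℚᵘ; toℚᵘ-homo-+; toℚᵘ-cong)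
open import Data.Rational.Unnormalised using (mkℚᵘ; *≡*; _≃_) renaming (_+_ to _+ᵘ_; _/_ to _/ᵘ_)
open import Data.Rational.Unnormalised.Properties using (drop-*≡*; ≃-trans; ≃-sym; ≃-reflexive; +-cong; *-cancelʳ-/)
open import Data.Fin using (Fin; zero; suc; punchIn)
open import Data.Fin.Properties using (punchInᵢ≢i; any?; _≟_)
open import Data.Vec.Functional using (removeAt)
open import Data.List using (tabulate; foldr)
open import Data.List.Properties using (map-tabulate)
open import Data.Product using (∃; _×_; _,_; proj₁; proj₂)
open import Data.Sum using (inj₁; inj₂)
open import Data.Empty using (⊥; ⊥-elim)
open import Function using (_∘_; id)
open import Function.Bundles using (_⇔_; Equivalence)
open import Function.Definitions using (Injective)
open import Relation.Binary.Definitions using (tri<; tri≈; tri>)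
open import Relation.Binary.PropositionalEquality
open import Relation.Nullary using (¬_; yes; no)

open import Algebra.Properties.Semiring.Sum +-*-semiring
  using (sum; ∑-comm; ∑-distrib-+; *-distribˡ-sum; *-distribʳ-sum; sum-remove; sum-cong-≗; sum-replicate-zero)
open import Algebra.Properties.CommutativeMonoid.Sum *-1-commutativeMonoid
  using () renaming (sum to prod; sum-remove to prod-remove; ∑-distrib-+ to ∏-distrib-*; sum-replicate-zero to prod-ones)
open import Algebra.Properties.CommutativeSemigroup *-commutativeSemigroup using (x∙yz≈y∙xz)

-- Finite sums and reindexing along injections

δ : ∀ {n} → Fin n → Fin n → ℕ
δ zero    zero    = 1
δ zero    (suc _) = 0
δ (suc _) zero    = 0
δ (suc i) (suc j) = δ i j

δ-refl : ∀ {n} (i : Fin n) → δ i i ≡ 1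
δ-refl zero    = refl
δ-refl (suc i) = δ-refl i

δ-≢ : ∀ {n} {i j : Fin n} → i ≢ j → δ i j ≡ 0
δ-≢ {i = zero}  {zero}  i≢j = ⊥-elim (i≢j refl)
δ-≢ {i = zero}  {suc j} i≢j = refl
δ-≢ {i = suc i} {zero}  i≢j = refl
δ-≢ {i = suc i} {suc j} i≢j = δ-≢ (i≢j ∘ cong suc)

sum-zero : ∀ {n} (f : Fin n → ℕ) → (∀ i → f i ≡ 0) → sum f ≡ 0
sum-zero {n} f f≡0 = trans (sum-cong-≗ f≡0) (sum-replicate-zero n)

sum-ones : ∀ n → sum {n} (λ _ → 1) ≡ n
sum-ones zero    = refl
sum-ones (suc n) = cong suc (sum-ones n)

sum≡0⇒≡0 : ∀ {n} (d : Fin n → ℕ) → sum d ≡ 0 → ∀ i → d i ≡ 0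
sum≡0⇒≡0 d Σd≡0 zero    = m+n≡0⇒m≡0 (d zero) Σd≡0
sum≡0⇒≡0 d Σd≡0 (suc i) = sum≡0⇒≡0 (d ∘ suc) (m+n≡0⇒n≡0 (d zero) Σd≡0) i

sum≡1⇒δ : ∀ {n} (d : Fin n → ℕ) → sum d ≡ 1 → ∃ λ t → ∀ i → d i ≡ δ t i
sum≡1⇒δ {suc n} d Σd≡1 with d zero in d₀
... | zero with t , d≡δt ← sum≡1⇒δ (d ∘ suc) Σd≡1 = suc t , λ { zero → d₀ ; (suc i) → d≡δt i }
... | suc zero = zero , λ { zero → d₀ ; (suc i) → sum≡0⇒≡0 (d ∘ suc) (suc-injective Σd≡1) i }
... | suc (suc _) with () ← suc-injective Σd≡1

∑-δ : ∀ {n} (i : Fin n) (g : Fin n → ℕ) → sum (λ j → δ i j * g j) ≡ g i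
∑-δ {suc n} i g = begin
  sum h                      ≡⟨ sum-remove {i = i} h ⟩
  h i + sum (removeAt h i)   ≡⟨ cong₂ _+_ (cong (_* g i) (δ-refl i)) (sum-zero (removeAt h i) off-diagonal) ⟩
  1 * g i + 0                ≡⟨ +-identityʳ (1 * g i) ⟩
  1 * g i                    ≡⟨ *-identityˡ (g i) ⟩
  g i                        ∎
  where
  open ≡-Reasoning
  h : Fin (suc n) → ℕ
  h j = δ i j * g j
  off-diagonal : ∀ j → h (punchIn i j) ≡ 0
  off-diagonal j = cong (_* g (punchIn i j)) (δ-≢ (punchInᵢ≢i i j ∘ sym))

multiplicity : ∀ {m n} → (Fin m → Fin n) → Fin n → ℕ
multiplicity f i = sum (λ j → δ (f j) i)

∑-reindex : ∀ {m n} (f : Fin m → Fin n) (g : Fin n → ℕ) →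
            sum (g ∘ f) ≡ sum (λ i → multiplicity f i * g i)
∑-reindex f g = begin
  sum (g ∘ f)                                  ≡⟨ sum-cong-≗ (λ j → sym (∑-δ (f j) g)) ⟩
  sum (λ j → sum (λ i → δ (f j) i * g i))      ≡⟨ ∑-comm (λ j i → δ (f j) i * g i) ⟩
  sum (λ i → sum (λ j → δ (f j) i * g i))      ≡⟨ sum-cong-≗ (λ i → *-distribʳ-sum (g i) (λ j → δ (f j) i)) ⟨
  sum (λ i → multiplicity f i * g i)           ∎
  where open ≡-Reasoning

sum-multiplicity : ∀ {m n} (f : Fin m → Fin n) → sum (multiplicity f) ≡ m
sum-multiplicity {m} f = begin
  sum (multiplicity f)                   ≡⟨ sum-cong-≗ (λ i → *-identityʳ (multiplicity f i)) ⟨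
  sum (λ i → multiplicity f i * 1)       ≡⟨ ∑-reindex f (λ _ → 1) ⟨
  sum {m} (λ _ → 1)                      ≡⟨ sum-ones m ⟩
  m                                      ∎
  where open ≡-Reasoning

multiplicity-∉ : ∀ {m n} (f : Fin m → Fin n) {i} → (∀ j → f j ≢ i) → multiplicity f i ≡ 0
multiplicity-∉ f f≢i = sum-zero _ (λ j → δ-≢ (f≢i j))

multiplicity-injective : ∀ {m n} {f : Fin m → Fin n} → Injective _≡_ _≡_ f →
                         ∀ {i j₀} → f j₀ ≡ i → multiplicity f i ≡ 1
multiplicity-injective {f = f} f-inj {i} {j₀} fj₀≡i = begin
  sum (λ j → δ (f j) i)      ≡⟨ sum-cong-≗ δ-f≡δ ⟩
  sum (λ j → δ j₀ j * 1)     ≡⟨ ∑-δ j₀ (λ _ → 1) ⟩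
  1                          ∎
  where
  open ≡-Reasoning
  δ-f≡δ : ∀ j → δ (f j) i ≡ δ j₀ j * 1
  δ-f≡δ j with j₀ ≟ j
  ... | yes refl = trans (cong (λ l → δ l i) fj₀≡i) (trans (δ-refl i) (cong (_* 1) (sym (δ-refl j₀))))
  ... | no j₀≢j  = trans (δ-≢ (j₀≢j ∘ f-inj ∘ trans fj₀≡i ∘ sym)) (cong (_* 1) (sym (δ-≢ j₀≢j)))

multiplicity≤1 : ∀ {m n} {f : Fin m → Fin n} → Injective _≡_ _≡_ f → ∀ i → multiplicity f i ≤ 1
multiplicity≤1 {f = f} f-inj i with any? (λ j → f j ≟ i)
... | yes (j , fj≡i) = ≤-reflexive (multiplicity-injective f-inj fj≡i)
... | no ∄j          = subst (_≤ 1) (sym (multiplicity-∉ f (λ j fj≡i → ∄j (j , fj≡i)))) z≤n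

missed : ∀ {m n} → (Fin m → Fin n) → Fin n → ℕ
missed f i = 1 ∸ multiplicity f i

sum-missed : ∀ {m} {k : Fin m → Fin (suc m)} → Injective _≡_ _≡_ k → sum (missed k) ≡ 1
sum-missed {m} {k} k-inj = +-cancelˡ-≡ m _ _ (begin
  m + sum (missed k)                          ≡⟨ cong (_+ sum (missed k)) (sum-multiplicity k) ⟨
  sum (multiplicity k) + sum (missed k)       ≡⟨ ∑-distrib-+ (multiplicity k) (missed k) ⟨
  sum (λ i → multiplicity k i + missed k i)   ≡⟨ sum-cong-≗ (λ i → m+[n∸m]≡n (multiplicity≤1 k-inj i)) ⟩
  sum {suc m} (λ _ → 1)                       ≡⟨ sum-ones (suc m) ⟩
  suc m                                       ≡⟨ +-comm 1 m ⟩
  m + 1                                       ∎)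
  where open ≡-Reasoning

injection-complement : ∀ {m} (k : Fin m → Fin (suc m)) → Injective _≡_ _≡_ k →
                       ∃ λ t → ∀ g → sum g ≡ sum (g ∘ k) + g t
injection-complement k k-inj with t , missed≡δt ← sum≡1⇒δ (missed k) (sum-missed k-inj) = t , split
  where
  split : ∀ g → sum g ≡ sum (g ∘ k) + g t
  split g = begin
    sum g                                                             ≡⟨ sum-cong-≗ partition ⟩
    sum (λ i → multiplicity k i * g i + missed k i * g i)             ≡⟨ ∑-distrib-+ (λ i → multiplicity k i * g i) (λ i → missed k i * g i) ⟩
    sum (λ i → multiplicity k i * g i) + sum (λ i → missed k i * g i) ≡⟨ cong₂ _+_ (sym (∑-reindex k g)) missed-part ⟩
    sum (g ∘ k) + g t                                                 ∎
    where
    open ≡-Reasoning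
    partition : ∀ i → g i ≡ multiplicity k i * g i + missed k i * g i
    partition i = begin
      g i                                             ≡⟨ *-identityˡ (g i) ⟨
      1 * g i                                         ≡⟨ cong (_* g i) (m+[n∸m]≡n (multiplicity≤1 k-inj i)) ⟨
      (multiplicity k i + missed k i) * g i           ≡⟨ *-distribʳ-+ (g i) (multiplicity k i) (missed k i) ⟩
      multiplicity k i * g i + missed k i * g i       ∎
    missed-part : sum (λ i → missed k i * g i) ≡ g t
    missed-part = trans (sum-cong-≗ (λ i → cong (_* g i) (missed≡δt i))) (∑-δ t g)

-- Elementary symmetric functions

σ-tabulate-vanishes : ∀ {n k} (f : Fin n → ℕ) → n < k → σ k (tabulate f) ≡ 0
σ-tabulate-vanishes {zero}  {suc k} f n<k = refl
σ-tabulate-vanishes {suc n} {suc k} f (s≤s n<k)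
  rewrite σ-tabulate-vanishes (f ∘ suc) n<k | σ-tabulate-vanishes (f ∘ suc) (m<n⇒m<1+n n<k) =
  trans (+-identityʳ _) (*-zeroʳ (f zero))

σ-tabulate-prod : ∀ {n} (f : Fin n → ℕ) → σ n (tabulate f) ≡ prod f
σ-tabulate-prod {zero}  f = refl
σ-tabulate-prod {suc n} f
  rewrite σ-tabulate-prod (f ∘ suc) | σ-tabulate-vanishes (f ∘ suc) (n<1+n n) = +-identityʳ _

σ-tabulate-removeAt : ∀ {m} (f : Fin (suc m) → ℕ) → σ m (tabulate f) ≡ sum (λ j → prod (removeAt f j))
σ-tabulate-removeAt {zero}  f = refl
σ-tabulate-removeAt {suc m} f = begin
  f zero * σ m (tabulate (f ∘ suc)) + σ (suc m) (tabulate (f ∘ suc))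
    ≡⟨ cong₂ _+_ (cong (f zero *_) (σ-tabulate-removeAt (f ∘ suc))) (σ-tabulate-prod (f ∘ suc)) ⟩
  f zero * sum (λ j → prod (removeAt (f ∘ suc) j)) + prod (f ∘ suc)
    ≡⟨ +-comm _ (prod (f ∘ suc)) ⟩
  prod (f ∘ suc) + f zero * sum (λ j → prod (removeAt (f ∘ suc) j))
    ≡⟨ cong (λ z → prod (f ∘ suc) + z) (*-distribˡ-sum (f zero) (λ j → prod (removeAt (f ∘ suc) j))) ⟩
  sum (λ j → prod (removeAt f j))
    ∎
  where open ≡-Reasoning

-- Clearing denominators

recip≃ : ∀ {x r c} .{{_ : NonZero x}} .{{_ : NonZero c}} → r * x ≡ c → toℚᵘ ((+ 1) /ℚ x) ≃ (+ r) /ᵘ c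
recip≃ {suc x} {r} {suc c} rx≡c = ≃-trans (toℚᵘ-fromℚᵘ (mkℚᵘ (+ 1) x))
  (*≡* (trans (ℤP.*-identityˡ (+ suc c)) (trans (cong +_ (sym rx≡c)) (ℤP.pos-* r (suc x)))))

+-/-distrib : ∀ a b c .{{_ : NonZero c}} → (+ a) /ᵘ c +ᵘ (+ b) /ᵘ c ≃ (+ (a + b)) /ᵘ c
+-/-distrib a b (suc c) = ≃-trans (≃-reflexive (cong (_/ᵘ (suc c * suc c)) numerator)) (*-cancelʳ-/ (suc c))
  where
  numerator : + a ℤ.* + suc c ℤ.+ + b ℤ.* + suc c ≡ + (a + b) ℤ.* + suc c
  numerator = trans (sym (ℤP.*-distribʳ-+ (+ suc c) (+ a) (+ b))) (cong (ℤ._* + suc c) (sym (ℤP.pos-+ a b)))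

toℚᵘ-sum-recip : ∀ {n} (x r : Fin n → ℕ) (pos : ∀ i → NonZero (x i)) {c} .{{_ : NonZero c}} →
                 (∀ i → r i * x i ≡ c) →
                 toℚᵘ (foldr _+ℚ_ 0ℚ (tabulate (λ i → ((+ 1) /ℚ x i) {{pos i}}))) ≃ (+ sum r) /ᵘ c
toℚᵘ-sum-recip {zero}  x r pos {suc c} rx≡c = *≡* refl
toℚᵘ-sum-recip {suc n} x r pos {c}     rx≡c =
  ≃-trans (toℚᵘ-homo-+ (((+ 1) /ℚ x zero) {{pos zero}}) _)
    (≃-trans (+-cong (recip≃ {{pos zero}} (rx≡c zero)) (toℚᵘ-sum-recip (x ∘ suc) (r ∘ suc) (pos ∘ suc) (rx≡c ∘ suc)))
             (+-/-distrib (r zero) (sum (r ∘ suc)) c))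

sumRecip≡1⇒sum≡ : ∀ {n} (x r : Fin n → ℕ) (pos : ∀ i → NonZero (x i)) {c} .{{_ : NonZero c}} →
                  (∀ i → r i * x i ≡ c) → sumRecip x pos ≡ 1ℚ → sum r ≡ c
sumRecip≡1⇒sum≡ x r pos {suc c} rx≡c Σ≡1 = ℤP.+-injective (begin
  + sum r               ≡⟨ ℤP.*-identityʳ (+ sum r) ⟨
  + sum r ℤ.* + 1       ≡⟨ drop-*≡* (≃-trans (≃-sym (toℚᵘ-sum-recip x r pos rx≡c)) (toℚᵘ-cong Σ≡1′)) ⟩
  + 1 ℤ.* + suc c       ≡⟨ ℤP.*-identityˡ (+ suc c) ⟩
  + suc c               ∎)
  where
  open ≡-Reasoning
  Σ≡1′ : foldr _+ℚ_ 0ℚ (tabulate (λ i → ((+ 1) /ℚ x i) {{pos i}})) ≡ 1ℚ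
  Σ≡1′ = trans (cong (foldr _+ℚ_ 0ℚ) (sym (map-tabulate id (λ i → ((+ 1) /ℚ x i) {{pos i}})))) Σ≡1

prod-nonZero : ∀ {n} (f : Fin n → ℕ) → (∀ i → NonZero (f i)) → NonZero (prod f)
prod-nonZero {zero}  f f≢0 = _
prod-nonZero {suc n} f f≢0 = m*n≢0 (f zero) (prod (f ∘ suc)) {{f≢0 zero}} {{prod-nonZero (f ∘ suc) (f≢0 ∘ suc)}}

cofactor-* : ∀ {n} q (y : Fin (suc n) → ℕ) {a α} → a ≤ α → ∀ i →
             q ^ (α ∸ a) * prod (removeAt y i) * (q ^ a * y i) ≡ q ^ α * prod y
cofactor-* q y {a} {α} a≤α i = begin
  q ^ (α ∸ a) * prod (removeAt y i) * (q ^ a * y i)   ≡⟨ rearrange (q ^ (α ∸ a)) (prod (removeAt y i)) (q ^ a) (y i) ⟩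
  q ^ (α ∸ a) * q ^ a * (y i * prod (removeAt y i))   ≡⟨ cong₂ _*_ (sym (^-distribˡ-+-* q (α ∸ a) a)) (sym (prod-remove {i = i} y)) ⟩
  q ^ (α ∸ a + a) * prod y                            ≡⟨ cong (λ e → q ^ e * prod y) (m∸n+n≡m a≤α) ⟩
  q ^ α * prod y                                      ∎
  where
  open ≡-Reasoning
  rearrange : ∀ A B C D → A * B * (C * D) ≡ A * C * (D * B)
  rearrange = solve-∀

-- Congruences modulo p

module Modular (p : ℕ) .{{_ : NonZero p}} where

  infix 4 _≋_
  _≋_ : ℕ → ℕ → Set
  a ≋ b = a % p ≡ b % p

  +-cong-≋ : ∀ {a b c d} → a ≋ b → c ≋ d → a + c ≋ b + d
  +-cong-≋ {a} {b} {c} {d} a≋b c≋d =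
    trans (%-distribˡ-+ a c p) (trans (cong₂ (λ u v → (u + v) % p) a≋b c≋d) (sym (%-distribˡ-+ b d p)))

  *-cong-≋ : ∀ {a b c d} → a ≋ b → c ≋ d → a * c ≋ b * d
  *-cong-≋ {a} {b} {c} {d} a≋b c≋d =
    trans (%-distribˡ-* a c p) (trans (cong₂ (λ u v → (u * v) % p) a≋b c≋d) (sym (%-distribˡ-* b d p)))

  sum-cong-≋ : ∀ {n} {f g : Fin n → ℕ} → (∀ i → f i ≋ g i) → sum f ≋ sum g
  sum-cong-≋ {zero}  f≋g = refl
  sum-cong-≋ {suc n} f≋g = +-cong-≋ (f≋g zero) (sum-cong-≋ (f≋g ∘ suc))

  prod-cong-≋ : ∀ {n} {f g : Fin n → ℕ} → (∀ i → f i ≋ g i) → prod f ≋ prod g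
  prod-cong-≋ {zero}  f≋g = refl
  prod-cong-≋ {suc n} f≋g = *-cong-≋ (f≋g zero) (prod-cong-≋ (f≋g ∘ suc))

  ∣⇒≋0 : ∀ {a} → p ∣ a → a ≋ 0
  ∣⇒≋0 {a} p∣a = trans (n∣m⇒m%n≡0 a p p∣a) (sym (n∣m⇒m%n≡0 0 p (p ∣0)))

  ≋0⇒∣ : ∀ {a} → a ≋ 0 → p ∣ a
  ≋0⇒∣ {a} a≋0 = m%n≡0⇒n∣m a p (trans a≋0 (n∣m⇒m%n≡0 0 p (p ∣0)))

  prod-removeAt-inverse : ∀ {n} (w z : Fin (suc n) → ℕ) → (∀ i → w i * z i ≋ 1) →
                          ∀ j → prod (removeAt w j) * prod z ≋ z j
  prod-removeAt-inverse {n} w z wz≋1 j = begin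
    prod (removeAt w j) * prod z % p                            ≡⟨ cong (λ Z → prod (removeAt w j) * Z % p) (prod-remove {i = j} z) ⟩
    prod (removeAt w j) * (z j * prod (removeAt z j)) % p       ≡⟨ cong (_% p) (x∙yz≈y∙xz (prod (removeAt w j)) (z j) _) ⟩
    z j * (prod (removeAt w j) * prod (removeAt z j)) % p       ≡⟨ cong (λ Z → z j * Z % p) (∏-distrib-* (removeAt w j) (removeAt z j)) ⟨
    z j * prod (λ i → w (punchIn j i) * z (punchIn j i)) % p    ≡⟨ *-cong-≋ {z j} refl (prod-cong-≋ (wz≋1 ∘ punchIn j)) ⟩
    z j * prod {n} (λ _ → 1) % p                                ≡⟨ cong (λ Z → z j * Z % p) (prod-ones n) ⟩
    z j * 1 % p                                                 ≡⟨ cong (_% p) (*-identityʳ (z j)) ⟩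
    z j % p                                                     ∎
    where open ≡-Reasoning

-- p-adic valuations

^-monoʳ-∣ : ∀ q {a b} → a ≤ b → q ^ a ∣ q ^ b
^-monoʳ-∣ q {a} {b} a≤b = divides (q ^ (b ∸ a)) (trans (cong (q ^_) (sym (m∸n+n≡m a≤b))) (^-distribˡ-+-* q (b ∸ a) a))

m∣m^n : ∀ m {n} → n ≢ 0 → m ∣ m ^ n
m∣m^n m {zero}  n≢0 = ⊥-elim (n≢0 refl)
m∣m^n m {suc n} _   = m∣m*n (m ^ n)

VP⇒factor : ∀ {p x a} → VP p x a → ∃ λ y → x ≡ p ^ a * y × ¬ p ∣ y
VP⇒factor {p} {x} {a} (divides y x≡y*pᵃ , pᵃ⁺¹∤x) = y , trans x≡y*pᵃ (*-comm y (p ^ a)) , p∤y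
  where
  p∤y : ¬ p ∣ y
  p∤y p∣y = pᵃ⁺¹∤x (subst (p * p ^ a ∣_) (sym x≡y*pᵃ) (*-monoˡ-∣ (p ^ a) p∣y))

VP-unique : ∀ {p x a b} → VP p x a → VP p x b → a ≡ b
VP-unique {p} {x} {a} {b} (pᵃ∣x , pᵃ⁺¹∤x) (pᵇ∣x , pᵇ⁺¹∤x) with <-cmp a b
... | tri< a<b _ _ = ⊥-elim (pᵃ⁺¹∤x (∣-trans (^-monoʳ-∣ p a<b) pᵇ∣x))
... | tri≈ _ a≡b _ = a≡b
... | tri> _ _ b<a = ⊥-elim (pᵇ⁺¹∤x (∣-trans (^-monoʳ-∣ p b<a) pᵃ∣x))

∤⇒VP-zero : ∀ {p y} → ¬ p ∣ y → VP p y 0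
∤⇒VP-zero {p} {y} p∤y = 1∣ y , p∤y ∘ subst (_∣ y) (*-identityʳ p)

VP-zero⇒∤ : ∀ {p y} → VP p y 0 → ¬ p ∣ y
VP-zero⇒∤ {p} {y} (_ , p¹∤y) = p¹∤y ∘ subst (_∣ y) (sym (*-identityʳ p))

module _ {p : ℕ} (p-prime : Prime p) where
  private instance
    p≢0 : NonZero p
    p≢0 = prime⇒nonZero p-prime
  open Modular p

  1≉0 : ¬ 1 ≋ 0
  1≉0 1≋0 = <⇒≢ (nonTrivial⇒n>1 p {{prime⇒nonTrivial p-prime}}) (sym (∣1⇒≡1 (≋0⇒∣ 1≋0)))

  ∤⇒coprime : ∀ {y} → ¬ p ∣ y → Coprime y p
  ∤⇒coprime p∤y (d∣y , d∣p) with prime⇒irreducible p-prime d∣p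
  ... | inj₁ d≡1 = d≡1
  ... | inj₂ refl = ⊥-elim (p∤y d∣y)

  inverse : ∀ {y} → ¬ p ∣ y → ∃ λ u → y * u ≋ 1
  inverse {y} p∤y with coprime-Bézout (∤⇒coprime p∤y)
  ... | Bézout.+- a b 1+bp≡ay = a , (begin
    y * a % p          ≡⟨ cong (_% p) (trans (*-comm y a) (sym 1+bp≡ay)) ⟩
    (1 + b * p) % p    ≡⟨ [m+kn]%n≡m%n 1 b p ⟩
    1 % p              ∎)
    where open ≡-Reasoning
  -- here a y ≡ -1, so (a y)² ≡ 1
  ... | Bézout.-+ a b 1+ay≡bp = a * a * y , (begin
    y * (a * a * y) % p                   ≡⟨ [m+kn]%n≡m%n _ (2 * b) p ⟨
    (y * (a * a * y) + 2 * b * p) % p     ≡⟨ cong (_% p) square ⟩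
    (1 + b * b * p * p) % p               ≡⟨ [m+kn]%n≡m%n 1 (b * b * p) p ⟩
    1 % p                                 ∎)
    where
    open ≡-Reasoning
    square : y * (a * a * y) + 2 * b * p ≡ 1 + b * b * p * p
    square = begin
      y * (a * a * y) + 2 * b * p             ≡⟨ lhs a y b p ⟩
      (a * y) * (a * y) + 2 * (b * p)         ≡⟨ cong (λ t → (a * y) * (a * y) + 2 * t) 1+ay≡bp ⟨
      (a * y) * (a * y) + 2 * (1 + a * y)     ≡⟨ middle (a * y) ⟩
      1 + (1 + a * y) * (1 + a * y)           ≡⟨ cong (λ t → 1 + t * t) 1+ay≡bp ⟩
      1 + (b * p) * (b * p)                   ≡⟨ rhs b p ⟩
      1 + b * b * p * p                       ∎
      where
      lhs : ∀ a y b p → y * (a * a * y) + 2 * b * p ≡ (a * y) * (a * y) + 2 * (b * p)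
      lhs = solve-∀
      middle : ∀ w → w * w + 2 * (1 + w) ≡ 1 + (1 + w) * (1 + w)
      middle = solve-∀
      rhs : ∀ b p → 1 + (b * p) * (b * p) ≡ 1 + b * b * p * p
      rhs = solve-∀

  top-inverses-sum≋0 :
    ∀ {n s} (x y a : Fin (suc n) → ℕ) (pos : ∀ i → NonZero (x i)) → sumRecip x pos ≡ 1ℚ →
    (∀ i → x i ≡ p ^ a i * y i) → (∀ i → ¬ p ∣ y i) →
    ∀ {α} → α ≢ 0 → (∀ i → a i ≤ α) →
    (idx : Fin s → Fin (suc n)) → Injective _≡_ _≡_ idx →
    (∀ t → a (idx t) ≡ α) → (∀ i → a i ≡ α → ∃ λ t → idx t ≡ i) →
    ∃ λ v → (∀ t → y (idx t) * v t ≋ 1) × sum v ≋ 0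
  top-inverses-sum≋0 x y a pos Σ≡1 x≡pᵃy p∤y {α} α≢0 a≤α idx idx-inj idx-top top-idx =
    u ∘ idx , yu≋1 ∘ idx , Σu≋0
    where
    open ≡-Reasoning
    u : Fin _ → ℕ
    u i = proj₁ (inverse (p∤y i))
    yu≋1 : ∀ i → y i * u i ≋ 1
    yu≋1 i = proj₂ (inverse (p∤y i))
    y≢0 : ∀ i → NonZero (y i)
    y≢0 i = ≢-nonZero (λ yᵢ≡0 → p∤y i (subst (p ∣_) (sym yᵢ≡0) (p ∣0)))
    instance
      c≢0 : NonZero (p ^ α * prod y)
      c≢0 = m*n≢0 (p ^ α) (prod y) {{m^n≢0 p α}} {{prod-nonZero y y≢0}}
    r : Fin _ → ℕ
    r i = p ^ (α ∸ a i) * prod (removeAt y i)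
    Σr≡c : sum r ≡ p ^ α * prod y
    Σr≡c = sumRecip≡1⇒sum≡ x r pos (λ i → trans (cong (r i *_) (x≡pᵃy i)) (cofactor-* p y (a≤α i) i)) Σ≡1
    term : ∀ i → r i * prod u ≋ multiplicity idx i * u i
    term i with m≤n⇒m<n∨m≡n (a≤α i)
    ... | inj₁ aᵢ<α = begin
      r i * prod u % p                   ≡⟨ ∣⇒≋0 (∣m⇒∣m*n (prod u) (∣m⇒∣m*n _ (m∣m^n p (m>n⇒m∸n≢0 aᵢ<α)))) ⟩
      0 % p                              ≡⟨ cong (λ f → f * u i % p) (multiplicity-∉ idx (λ t → <⇒≢ aᵢ<α ∘ idx≡i⇒aᵢ≡α t)) ⟨
      multiplicity idx i * u i % p       ∎
      where
      idx≡i⇒aᵢ≡α : ∀ t → idx t ≡ i → a i ≡ α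
      idx≡i⇒aᵢ≡α t idxₜ≡i = trans (cong a (sym idxₜ≡i)) (idx-top t)
    ... | inj₂ aᵢ≡α = begin
      p ^ (α ∸ a i) * prod (removeAt y i) * prod u % p   ≡⟨ cong (λ e → p ^ e * prod (removeAt y i) * prod u % p) (trans (cong (α ∸_) aᵢ≡α) (n∸n≡0 α)) ⟩
      1 * prod (removeAt y i) * prod u % p               ≡⟨ cong (λ z → z * prod u % p) (*-identityˡ (prod (removeAt y i))) ⟩
      prod (removeAt y i) * prod u % p                   ≡⟨ prod-removeAt-inverse y u yu≋1 i ⟩
      u i % p                                            ≡⟨ cong (_% p) (*-identityˡ (u i)) ⟨
      1 * u i % p                                        ≡⟨ cong (λ f → f * u i % p) (multiplicity-injective idx-inj (proj₂ (top-idx i aᵢ≡α))) ⟨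
      multiplicity idx i * u i % p                       ∎
    Σu≋0 : sum (u ∘ idx) ≋ 0
    Σu≋0 = begin
      sum (u ∘ idx) % p                           ≡⟨ cong (_% p) (∑-reindex idx u) ⟩
      sum (λ i → multiplicity idx i * u i) % p    ≡⟨ sum-cong-≋ term ⟨
      sum (λ i → r i * prod u) % p                ≡⟨ cong (_% p) (*-distribʳ-sum (prod u) r) ⟨
      sum r * prod u % p                          ≡⟨ cong (λ z → z * prod u % p) Σr≡c ⟩
      p ^ α * prod y * prod u % p                 ≡⟨ ∣⇒≋0 (∣m⇒∣m*n (prod u) (∣m⇒∣m*n (prod y) (m∣m^n p α≢0))) ⟩
      0 % p                                       ∎

  top-inverses-sum≋0-VP :
    ∀ {n} (x : Fin n → ℕ) (pos : ∀ i → NonZero (x i)) → sumRecip x pos ≡ 1ℚ → ∃ (λ i → p ∣ x i) →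
    ∀ α → (∀ i → ∃ (λ a → VP p (x i) a × a ≤ α)) →
    ∀ {s} (idx : Fin s → Fin n) → Injective _≡_ _≡_ idx → (∀ i → VP p (x i) α ⇔ ∃ (λ t → idx t ≡ i)) →
    (x′ : Fin s → ℕ) → (∀ t → x (idx t) ≡ p ^ α * x′ t) →
    ∃ λ v → (∀ t → x′ t * v t ≋ 1) × sum v ≋ 0
  top-inverses-sum≋0-VP {suc n} x pos Σ≡1 (i₀ , p∣xᵢ₀) α bounded idx idx-inj top⇔idx x′ x∘idx≡pᵅx′ =
    let v , yv≋1 , Σv≋0 = top-inverses-sum≋0 x y a pos Σ≡1 x≡pᵃy p∤y α≢0 a≤α idx idx-inj idx-top top-idx
    in v , (λ t → subst (λ z → z * v t ≋ 1) (y∘idx≡x′ t) (yv≋1 t)) , Σv≋0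
    where
    a : Fin (suc n) → ℕ
    a i = proj₁ (bounded i)
    vₚ≡a : ∀ i → VP p (x i) (a i)
    vₚ≡a i = proj₁ (proj₂ (bounded i))
    a≤α : ∀ i → a i ≤ α
    a≤α i = proj₂ (proj₂ (bounded i))
    factor : ∀ i → ∃ λ y → x i ≡ p ^ a i * y × ¬ p ∣ y
    factor i = VP⇒factor {p} {x i} {a i} (vₚ≡a i)
    y : Fin (suc n) → ℕ
    y i = proj₁ (factor i)
    x≡pᵃy : ∀ i → x i ≡ p ^ a i * y i
    x≡pᵃy i = proj₁ (proj₂ (factor i))
    p∤y : ∀ i → ¬ p ∣ y i
    p∤y i = proj₂ (proj₂ (factor i))
    α≢0 : α ≢ 0
    α≢0 α≡0 = VP-zero⇒∤ (subst (VP p (x i₀)) (n≤0⇒n≡0 (subst (a i₀ ≤_) α≡0 (a≤α i₀))) (vₚ≡a i₀)) p∣xᵢ₀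
    idx-top : ∀ t → a (idx t) ≡ α
    idx-top t = VP-unique (vₚ≡a (idx t)) (Equivalence.from (top⇔idx (idx t)) (t , refl))
    top-idx : ∀ i → a i ≡ α → ∃ λ t → idx t ≡ i
    top-idx i aᵢ≡α = Equivalence.to (top⇔idx i) (subst (VP p (x i)) aᵢ≡α (vₚ≡a i))
    y∘idx≡x′ : ∀ t → y (idx t) ≡ x′ t
    y∘idx≡x′ t = *-cancelˡ-≡ (y (idx t)) (x′ t) (p ^ α) {{m^n≢0 p α}} (begin
      p ^ α * y (idx t)           ≡⟨ cong (λ e → p ^ e * y (idx t)) (idx-top t) ⟨
      p ^ a (idx t) * y (idx t)   ≡⟨ x≡pᵃy (idx t) ⟨
      x (idx t)                   ≡⟨ x∘idx≡pᵅx′ t ⟩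
      p ^ α * x′ t                ∎)
      where open ≡-Reasoning

  σ-complement-not-divisible :
    ∀ {m} (x′ v : Fin (suc (suc m)) → ℕ) → (∀ t → x′ t * v t ≋ 1) → sum v ≋ 0 →
    (k : Fin (suc m) → Fin (suc (suc m))) → Injective _≡_ _≡_ k →
    ¬ p ∣ σ m (tabulate (x′ ∘ k))
  σ-complement-not-divisible {m} x′ v x′v≋1 Σv≋0 k k-inj p∣σ = missed-inverse-vanishes (injection-complement k k-inj)
    where
    open ≡-Reasoning
    Σv∘k≋0 : sum (v ∘ k) ≋ 0
    Σv∘k≋0 = begin
      sum (v ∘ k) % p                                             ≡⟨ sum-cong-≋ (prod-removeAt-inverse (x′ ∘ k) (v ∘ k) (x′v≋1 ∘ k)) ⟨
      sum (λ j → prod (removeAt (x′ ∘ k) j) * prod (v ∘ k)) % p   ≡⟨ cong (_% p) (*-distribʳ-sum (prod (v ∘ k)) (λ j → prod (removeAt (x′ ∘ k) j))) ⟨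
      sum (λ j → prod (removeAt (x′ ∘ k) j)) * prod (v ∘ k) % p   ≡⟨ cong (λ z → z * prod (v ∘ k) % p) (σ-tabulate-removeAt (x′ ∘ k)) ⟨
      σ m (tabulate (x′ ∘ k)) * prod (v ∘ k) % p                  ≡⟨ ∣⇒≋0 (∣m⇒∣m*n (prod (v ∘ k)) p∣σ) ⟩
      0 % p                                                       ∎
    missed-inverse-vanishes : (∃ λ t → ∀ g → sum g ≡ sum (g ∘ k) + g t) → ⊥
    missed-inverse-vanishes (t , split) = 1≉0 (begin
      1 % p                 ≡⟨ x′v≋1 t ⟨
      x′ t * v t % p        ≡⟨ *-cong-≋ {x′ t} refl vₜ≋0 ⟩
      x′ t * 0 % p          ≡⟨ cong (_% p) (*-zeroʳ (x′ t)) ⟩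
      0 % p                 ∎)
      where
      vₜ≋0 : v t ≋ 0
      vₜ≋0 = begin
        v t % p                   ≡⟨ +-cong-≋ Σv∘k≋0 (refl {x = v t % p}) ⟨
        (sum (v ∘ k) + v t) % p   ≡⟨ cong (_% p) (split v) ⟨
        sum v % p                 ≡⟨ Σv≋0 ⟩
        0 % p                     ∎

corollary4 : (p : ℕ) → Prime p →
    (n : ℕ) (x : Fin n → ℕ) (pos : ∀ i → NonZero (x i)) →
    sumRecip x pos ≡ 1ℚ →
    ∃ (λ i → p ∣ x i) →
    (α : ℕ) → (∀ i → ∃ (λ a → VP p (x i) a × a ≤ α)) → ∃ (λ i → VP p (x i) α) →
    (s : ℕ) (idx : Fin s → Fin n) → Injective _≡_ _≡_ idx →
    (∀ i → VP p (x i) α ⇔ ∃ (λ t → idx t ≡ i)) →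
    2 ≤ s →
    (x′ : Fin s → ℕ) → (∀ t → x (idx t) ≡ p ^ α * x′ t × ¬ (p ∣ x′ t)) →
    (k : Fin (s ∸ 1) → Fin s) → Injective _≡_ _≡_ k →
    VP p (σ (s ∸ 2) (listOf (λ j → x′ (k j)))) 0
corollary4 p p-prime n x pos Σ≡1 p∣x α bounded _ (suc (suc m)) idx idx-inj top⇔idx (s≤s (s≤s _)) x′ x′-spec k k-inj =
  let v , x′v≋1 , Σv≋0 = top-inverses-sum≋0-VP p-prime x pos Σ≡1 p∣x α bounded idx idx-inj top⇔idx x′ (proj₁ ∘ x′-spec)
  in ∤⇒VP-zero (σ-complement-not-divisible p-prime x′ v x′v≋1 Σv≋0 k k-inj ∘ subst (p ∣_) listOf≡tabulate)
  where
  listOf≡tabulate : σ m (listOf (x′ ∘ k)) ≡ σ m (tabulate (x′ ∘ k))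
  listOf≡tabulate = cong (σ m) (map-tabulate id (x′ ∘ k))
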